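{- Let $n>2k>0$ and let $\mathcal F\subset\binom{[n]}{k}$ be a nontrivially intersecting shifted family. Let $F\in\mathcal F$ be the set of maximal order in $\mathcal F$. Let $l\ge 1$ be the largest integer with $|F\cap[2l-1]|=l$, put $L:=[2l]\setminus F$, and define $$\mathcal A:=\Big\{A\in\tbinom{[n]}{k}: A\cap[2l]=F\cap[2l]\Big\},\qquad \mathcal B:=\Big\{B\in\tbinom{[n]}{k}: B\cap[2l]=L\Big\}.$$ Then the family $\mathcal F':=(\mathcal F\setminus\mathcal A)\cup\mathcal B$ is intersecting and has smaller order than $\mathcal F$. Moreover, $|\mathcal F'|\ge|\mathcal F|$.
   Context: $[n]=\{1,\dots,n\}$ and $\binom{[n]}{k}$ is the family of all $k$-element subsets of $[n]$. A family is intersecting if any two of its sets intersect; it is trivially intersecting if all its sets contain a common element, and nontrivially intersecting otherwise. For $1\le i<j\le n$ and $A\subset[n]$, the shift $S_{i,j}(A)$ equals $(A\setminus\{j\})\cup\{i\}$ if $j\in A$, $i\notin A$, and equals $A$ otherwise; for a family, $S_{i,j}(\mathcal F):=\{S_{i,j}(A):A\in\mathcal F\}\cup\{A: A,S_{i,j}(A)\in\mathcal F\}$. $\mathcal F$ is shifted if $S_{i,j}(\mathcal F)=\mathcal F$ for all $1\le i<j\le n$. For distinct $A,B\in\binom{[n]}{k}$, $A$ lexicographically precedes $B$ if the smallest element of $A\setminus B$ is smaller than the smallest element of $B\setminus A$. The order of a $k$-set is its position in the lexicographic order on $\binom{[n]}{k}$; the order of a family is the maximal order of its members. (For $F$ as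 in the statement, an integer $l\ge1$ with $|F\cap[2l-1]|=l$ exists.) -}

module Defs where

open import Data.Nat using (ℕ; zero; suc; _+_; _*_; _∸_; _<ᵇ_; _≡ᵇ_; _<_; _≤_)
open import Data.Bool using (Bool; true; false; T; not; _∧_; _∨_; if_then_else_)
import Data.Bool.Properties as BoolP
open import Data.Fin using (Fin; toℕ)
open import Data.Fin.Subset using (Subset; _∈_; _∩_; _─_; ∣_∣; Nonempty)
open import Data.Vec using (Vec; []; _∷_; lookup; tabulate; _[_]≔_)
open import Data.Vec.Properties using (≡-dec)
open import Data.List using (List; []; _∷_; map; _++_; filter; length)
open import Data.Product using (Σ; ∃; _×_; _,_)
open import Data.Empty using (⊥)
open import Data.Unit using (⊤)
open import Relation.Nullary using (¬_; does)
open import Relation.Binary.PropositionalEquality using (_≡_; _≢_)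
open import Relation.Unary using (Pred)

-- A family of subsets of [n] is given by a Boolean membership predicate.
-- Subsets of [n] are `Subset n` (Vec Bool n); index i : Fin n stands for
-- the element toℕ i + 1 of [n].
Family : ℕ → Set
Family n = Subset n → Bool

_∈F_ : ∀ {n} → Subset n → Family n → Set
A ∈F 𝓕 = T (𝓕 A)

_==ˢ_ : ∀ {n} → Subset n → Subset n → Bool
A ==ˢ B = does (≡-dec BoolP._≟_ A B)

UniformFamily : ∀ {n} → ℕ → Family n → Set
UniformFamily k 𝓕 = ∀ A → A ∈F 𝓕 → ∣ A ∣ ≡ k

Intersecting : ∀ {n} → Family n → Set
Intersecting 𝓕 = ∀ A B → A ∈F 𝓕 → B ∈F 𝓕 → Nonempty (A ∩ B)

TriviallyIntersecting : ∀ {n} → Family n → Set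
TriviallyIntersecting {n} 𝓕 = Σ (Fin n) λ x → ∀ A → A ∈F 𝓕 → x ∈ A

NontriviallyIntersecting : ∀ {n} → Family n → Set
NontriviallyIntersecting 𝓕 = Intersecting 𝓕 × ¬ TriviallyIntersecting 𝓕

shiftSet : ∀ {n} → Fin n → Fin n → Subset n → Subset n
shiftSet i j A =
  if lookup A j ∧ not (lookup A i) then ((A [ j ]≔ false) [ i ]≔ true) else A

_∈Shift[_,_]_ : ∀ {n} → Subset n → Fin n → Fin n → Family n → Set
A ∈Shift[ i , j ] 𝓕 =
  (Σ _ λ B → B ∈F 𝓕 × shiftSet i j B ≡ A) ⊎' (A ∈F 𝓕 × shiftSet i j A ∈F 𝓕)
  where
  open import Data.Sum renaming (_⊎_ to _⊎'_)

Shifted : ∀ {n} → Family n → Set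
Shifted {n} 𝓕 = ∀ (i j : Fin n) → toℕ i < toℕ j →
  ∀ A → (A ∈Shift[ i , j ] 𝓕 → A ∈F 𝓕) × (A ∈F 𝓕 → A ∈Shift[ i , j ] 𝓕)

-- Lexicographic precedence: A ≺ B iff min(A∖B) < min(B∖A), i.e. at the
-- first position where A and B differ, the element belongs to A.
_≺_ : ∀ {n} → Subset n → Subset n → Set
[] ≺ [] = ⊥
(true ∷ A) ≺ (true ∷ B) = A ≺ B
(false ∷ A) ≺ (false ∷ B) = A ≺ B
(true ∷ A) ≺ (false ∷ B) = ⊤
(false ∷ A) ≺ (true ∷ B) = ⊥

seg : ∀ n → ℕ → Subset n
seg n m = tabulate λ i → toℕ i <ᵇ m

allSubsets : ∀ n → List (Subset n)
allSubsets zero = [] ∷ []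
allSubsets (suc n) = map (true ∷_) (allSubsets n) ++ map (false ∷_) (allSubsets n)

size : ∀ {n} → Family n → ℕ
size {n} 𝓕 = length (filter (λ A → T? (𝓕 A)) (allSubsets n))
  where open import Data.Bool.Properties using (T?)

famA : ∀ {n} → ℕ → ℕ → Subset n → Family n
famA {n} k l F A = (∣ A ∣ ≡ᵇ k) ∧ ((A ∩ seg n (2 * l)) ==ˢ (F ∩ seg n (2 * l)))

famB : ∀ {n} → ℕ → ℕ → Subset n → Family n
famB {n} k l F B = (∣ B ∣ ≡ᵇ k) ∧ ((B ∩ seg n (2 * l)) ==ˢ (seg n (2 * l) ─ F))

newFamily : ∀ {n} → ℕ → ℕ → Subset n → Family n → Family n
newFamily k l F 𝓕 A = (𝓕 A ∧ not (famA k l F A)) ∨ famB k l F A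

-- Since 𝓕 is not a star, its lex-last member F avoids 1, while every member of 𝓑 contains 1
-- (l ≥ 1); so 𝓑 precedes F, and 𝓑 is intersecting. A member G of 𝓕 ∖ 𝓐 precedes F and
-- first differs from F inside [2l], at an element of G ∖ F ⊆ L, so G meets every member of 𝓑.
-- For the size, write n = 2l + m and U = F ∩ [2l]; then L = [2l] ∖ U and |L| ≤ |U|. The members
-- of 𝓕 ∩ 𝓐 and of 𝓕 ∩ 𝓑 have the form U ∪ S and L ∪ T, and their traces S, T on the last m
-- points form two shifted cross-intersecting families, uniform of sizes a = k − |U| ≤ b = k − |L|
-- with a + b < m. Such families satisfy |𝓢| + |𝓣| ≤ C(m, b) = |𝓑|: by induction on m, splitting
-- on the last point (shifting moves that point into a free position to keep the traces containing
-- it cross-intersecting), and by complementing 𝓢 when a + b = m. Hence |𝓕 ∩ 𝓐| + |𝓕 ∩ 𝓑| ≤ |𝓑|,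
-- which is |𝓕′| ≥ |𝓕|.

module Submission where

open import Defs
open import Data.Nat using (ℕ; _*_; _∸_; _<_; _≤_; _≥_)
open import Data.Fin.Subset using (Subset; _∩_; ∣_∣)
open import Data.Product using (_×_)
open import Relation.Binary.PropositionalEquality using (_≡_; _≢_)

open import Data.Nat using (zero; suc; _+_; _≡ᵇ_; _≟_; z≤n; s≤s; s≤s⁻¹; z<s)
open import Data.Nat.Properties
open import Algebra.Properties.CommutativeSemigroup +-commutativeSemigroup using (interchange)
open import Data.Bool using (Bool; true; false; T; not; _∧_; if_then_else_)
import Data.Bool.Properties as BoolP
open import Data.Bool.Properties using (T?; T-∧; T-∨; T-not-≡; ∧-identityʳ; ∧-zeroʳ)
open import Data.Vec using ([]; _∷_; _++_; _∷ʳ_; lookup; _[_]≔_; here; there; splitAt; head)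
open import Data.Vec.Properties using (≡-dec; ++-injectiveˡ; ∷-injectiveʳ)
open import Data.List using (List; []; _∷_; filter; length) renaming (map to mapᴸ; _++_ to _++ᴸ_)
import Data.List.Properties as ListP
open import Data.Fin using (Fin; zero; suc; toℕ)
open import Data.Fin.Subset using (_∈_; _─_; ∁; Nonempty) renaming (⊥ to ∅)
open import Data.Fin.Subset.Properties using (x∈p∩q⁺; x∈p∩q⁻; ∣p∩q∣≤∣p∣; ∣∁p∣≡n∸∣p∣; ∣p∣≤n; ∣⊥∣≡0)
open import Data.Product using (∃; ∃₂; _,_; proj₁; proj₂; uncurry)
open import Data.Sum using (_⊎_; inj₁; inj₂; map₁; map₂)
open import Data.Empty using (⊥; ⊥-elim)
open import Data.Unit using (tt)
open import Function using (_∘_; Equivalence)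
open import Relation.Nullary using (¬_; yes; no)
open import Relation.Binary.PropositionalEquality using (refl; sym; trans; cong; cong₂; subst; subst₂; module ≡-Reasoning)

open Equivalence using (to; from)

-- Counting subsets

+-interchange : ∀ a b c d → (a + b) + (c + d) ≡ (a + c) + (b + d)
+-interchange = interchange

χ : Bool → ℕ
χ true  = 1
χ false = 0

∑ : ∀ m → (Subset m → ℕ) → ℕ
∑ zero    f = f []
∑ (suc m) f = ∑ m (f ∘ (true ∷_)) + ∑ m (f ∘ (false ∷_))

∑-cong : ∀ m {f g : Subset m → ℕ} → (∀ A → f A ≡ g A) → ∑ m f ≡ ∑ m g
∑-cong zero    f≗g = f≗g []
∑-cong (suc m) f≗g = cong₂ _+_ (∑-cong m (f≗g ∘ (true ∷_))) (∑-cong m (f≗g ∘ (false ∷_)))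

∑-mono-≤ : ∀ m {f g : Subset m → ℕ} → (∀ A → f A ≤ g A) → ∑ m f ≤ ∑ m g
∑-mono-≤ zero    f≤g = f≤g []
∑-mono-≤ (suc m) f≤g = +-mono-≤ (∑-mono-≤ m (f≤g ∘ (true ∷_))) (∑-mono-≤ m (f≤g ∘ (false ∷_)))

∑-zero : ∀ m {f : Subset m → ℕ} → (∀ A → f A ≡ 0) → ∑ m f ≡ 0
∑-zero zero    f≗0 = f≗0 []
∑-zero (suc m) f≗0 = cong₂ _+_ (∑-zero m (f≗0 ∘ (true ∷_))) (∑-zero m (f≗0 ∘ (false ∷_)))

∑-distrib-+ : ∀ m (f g : Subset m → ℕ) → ∑ m (λ A → f A + g A) ≡ ∑ m f + ∑ m g
∑-distrib-+ zero    f g = refl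
∑-distrib-+ (suc m) f g = trans
  (cong₂ _+_ (∑-distrib-+ m (f ∘ (true ∷_)) (g ∘ (true ∷_))) (∑-distrib-+ m (f ∘ (false ∷_)) (g ∘ (false ∷_))))
  (+-interchange (∑ m (f ∘ (true ∷_))) (∑ m (g ∘ (true ∷_))) (∑ m (f ∘ (false ∷_))) (∑ m (g ∘ (false ∷_))))

∑-∷ʳ : ∀ m (f : Subset (suc m) → ℕ) → ∑ (suc m) f ≡ ∑ m (f ∘ (_∷ʳ true)) + ∑ m (f ∘ (_∷ʳ false))
∑-∷ʳ zero    f = refl
∑-∷ʳ (suc m) f = trans (cong₂ _+_ (∑-∷ʳ m (f ∘ (true ∷_))) (∑-∷ʳ m (f ∘ (false ∷_))))
  (+-interchange (∑ m (f ∘ (true ∷_) ∘ (_∷ʳ true))) (∑ m (f ∘ (true ∷_) ∘ (_∷ʳ false)))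
                 (∑ m (f ∘ (false ∷_) ∘ (_∷ʳ true))) (∑ m (f ∘ (false ∷_) ∘ (_∷ʳ false))))

∑-∁ : ∀ m (f : Subset m → ℕ) → ∑ m (f ∘ ∁) ≡ ∑ m f
∑-∁ zero    f = refl
∑-∁ (suc m) f = trans (cong₂ _+_ (∑-∁ m (f ∘ (false ∷_))) (∑-∁ m (f ∘ (true ∷_))))
  (+-comm (∑ m (f ∘ (false ∷_))) (∑ m (f ∘ (true ∷_))))

∑-++-zero : ∀ p m (f : Subset (p + m) → ℕ) → (∀ X Y → f (X ++ Y) ≡ 0) → ∑ (p + m) f ≡ 0
∑-++-zero p m f f≗0 = ∑-zero (p + m) vanish
  where
  vanish : ∀ A → f A ≡ 0
  vanish A with splitAt p A
  ... | X , Y , refl = f≗0 X Y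

∑-++ : ∀ p m (f : Subset (p + m) → ℕ) (v : Subset p) →
       (∀ X Y → X ≢ v → f (X ++ Y) ≡ 0) → ∑ (p + m) f ≡ ∑ m (f ∘ (v ++_))
∑-++ zero    m f []         _   = refl
∑-++ (suc p) m f (true ∷ v) off = trans
  (cong₂ _+_ (∑-++ p m (f ∘ (true ∷_)) v (λ X Y X≢v → off (true ∷ X) Y (X≢v ∘ ∷-injectiveʳ)))
             (∑-++-zero p m (f ∘ (false ∷_)) (λ X Y → off (false ∷ X) Y λ ())))
  (+-identityʳ _)
∑-++ (suc p) m f (false ∷ v) off =
  cong₂ _+_ (∑-++-zero p m (f ∘ (true ∷_)) (λ X Y → off (true ∷ X) Y λ ()))
            (∑-++ p m (f ∘ (false ∷_)) v (λ X Y X≢v → off (false ∷ X) Y (X≢v ∘ ∷-injectiveʳ)))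

∑-++-≥ : ∀ p m (f : Subset (p + m) → ℕ) (v : Subset p) → ∑ m (f ∘ (v ++_)) ≤ ∑ (p + m) f
∑-++-≥ zero    m f []          = ≤-refl
∑-++-≥ (suc p) m f (true ∷ v)  = ≤-trans (∑-++-≥ p m (f ∘ (true ∷_)) v) (m≤m+n _ _)
∑-++-≥ (suc p) m f (false ∷ v) = ≤-trans (∑-++-≥ p m (f ∘ (false ∷_)) v) (m≤n+m _ _)

count : ∀ m → Family m → ℕ
count m 𝓕 = ∑ m (χ ∘ 𝓕)

χ-false : ∀ {a} → ¬ T a → χ a ≡ 0
χ-false {false} _  = refl
χ-false {true}  ¬a = ⊥-elim (¬a tt)

χ-mono : ∀ {a b} → (T a → T b) → χ a ≤ χ b
χ-mono {false}         _   = z≤n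
χ-mono {true}  {true}  _   = ≤-refl
χ-mono {true}  {false} a⇒b = ⊥-elim (a⇒b tt)

χ-disjoint : ∀ {a b c} → (T a → T c) → (T b → T c) → (T a → ¬ T b) → χ a + χ b ≤ χ c
χ-disjoint {false}         _   b⇒c _    = χ-mono b⇒c
χ-disjoint {true}  {false} a⇒c _   _    = ≤-trans (≤-reflexive (+-identityʳ 1)) (χ-mono a⇒c)
χ-disjoint {true}  {true}  _   _   a⇒¬b = ⊥-elim (a⇒¬b tt tt)

χ-split : ∀ a b → χ a ≡ χ (a ∧ not b) + χ (a ∧ b)
χ-split false _     = refl
χ-split true  false = refl
χ-split true  true  = refl

_∩ᶠ_ : ∀ {m} → Family m → Family m → Family m
(𝓕 ∩ᶠ 𝓖) A = 𝓕 A ∧ 𝓖 A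

_∖ᶠ_ : ∀ {m} → Family m → Family m → Family m
(𝓕 ∖ᶠ 𝓖) A = 𝓕 A ∧ not (𝓖 A)

∩ᶠ⇒∈ˡ : ∀ {m} (𝓕 𝓖 : Family m) A → A ∈F (𝓕 ∩ᶠ 𝓖) → A ∈F 𝓕
∩ᶠ⇒∈ˡ 𝓕 𝓖 A A∈ = proj₁ (to (T-∧ {𝓕 A} {𝓖 A}) A∈)

∩ᶠ⇒∈ʳ : ∀ {m} (𝓕 𝓖 : Family m) A → A ∈F (𝓕 ∩ᶠ 𝓖) → A ∈F 𝓖
∩ᶠ⇒∈ʳ 𝓕 𝓖 A A∈ = proj₂ (to (T-∧ {𝓕 A} {𝓖 A}) A∈)

∖ᶠ⇒∈ : ∀ {m} (𝓕 𝓖 : Family m) A → A ∈F (𝓕 ∖ᶠ 𝓖) → A ∈F 𝓕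
∖ᶠ⇒∈ _ _ A A∈ = proj₁ (to T-∧ A∈)

∖ᶠ⇒∉ : ∀ {m} (𝓕 𝓖 : Family m) A → A ∈F (𝓕 ∖ᶠ 𝓖) → ¬ A ∈F 𝓖
∖ᶠ⇒∉ _ _ A A∈ = subst T (to T-not-≡ (proj₂ (to T-∧ A∈)))

count-cong : ∀ m {𝓕 𝓖 : Family m} → (∀ A → 𝓕 A ≡ 𝓖 A) → count m 𝓕 ≡ count m 𝓖
count-cong m 𝓕≗𝓖 = ∑-cong m (cong χ ∘ 𝓕≗𝓖)

count-mono : ∀ m {𝓕 𝓖 : Family m} → (∀ A → A ∈F 𝓕 → A ∈F 𝓖) → count m 𝓕 ≤ count m 𝓖
count-mono m 𝓕⊆𝓖 = ∑-mono-≤ m (χ-mono ∘ 𝓕⊆𝓖)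

count-empty : ∀ m {𝓕 : Family m} → (∀ A → ¬ A ∈F 𝓕) → count m 𝓕 ≡ 0
count-empty m 𝓕≗∅ = ∑-zero m (χ-false ∘ 𝓕≗∅)

count-split : ∀ m (𝓕 𝓖 : Family m) → count m 𝓕 ≡ count m (𝓕 ∖ᶠ 𝓖) + count m (𝓕 ∩ᶠ 𝓖)
count-split m 𝓕 𝓖 = trans (∑-cong m (λ A → χ-split (𝓕 A) (𝓖 A))) (∑-distrib-+ m _ _)

count-disjoint : ∀ m {𝓕 𝓖 𝓗 : Family m} → (∀ A → A ∈F 𝓕 → A ∈F 𝓗) → (∀ A → A ∈F 𝓖 → A ∈F 𝓗) →
                 (∀ A → A ∈F 𝓕 → ¬ A ∈F 𝓖) → count m 𝓕 + count m 𝓖 ≤ count m 𝓗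
count-disjoint m {𝓕} {𝓖} 𝓕⊆𝓗 𝓖⊆𝓗 𝓕∩𝓖≡∅ = ≤-trans
  (≤-reflexive (sym (∑-distrib-+ m (χ ∘ 𝓕) (χ ∘ 𝓖))))
  (∑-mono-≤ m (λ A → χ-disjoint (𝓕⊆𝓗 A) (𝓖⊆𝓗 A) (𝓕∩𝓖≡∅ A)))

count-∷ʳ : ∀ m (𝓕 : Family (suc m)) → count (suc m) 𝓕 ≡ count m (𝓕 ∘ (_∷ʳ true)) + count m (𝓕 ∘ (_∷ʳ false))
count-∷ʳ m 𝓕 = ∑-∷ʳ m (χ ∘ 𝓕)

count-∁ : ∀ m (𝓕 : Family m) → count m (𝓕 ∘ ∁) ≡ count m 𝓕
count-∁ m 𝓕 = ∑-∁ m (χ ∘ 𝓕)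

count-++ : ∀ p m (𝓕 : Family (p + m)) (v : Subset p) →
           (∀ X Y → (X ++ Y) ∈F 𝓕 → X ≡ v) → count (p + m) 𝓕 ≡ count m (𝓕 ∘ (v ++_))
count-++ p m 𝓕 v prefix = ∑-++ p m (χ ∘ 𝓕) v (λ X Y X≢v → χ-false (X≢v ∘ prefix X Y))

count-++-≥ : ∀ p m (𝓕 : Family (p + m)) (v : Subset p) → count m (𝓕 ∘ (v ++_)) ≤ count (p + m) 𝓕
count-++-≥ p m 𝓕 = ∑-++-≥ p m (χ ∘ 𝓕)

length-filter-map : ∀ {n m} (P : Subset m → Bool) (f : Subset n → Subset m) (xs : List (Subset n)) →
  length (filter (T? ∘ P) (mapᴸ f xs)) ≡ length (filter (T? ∘ P ∘ f) xs)
length-filter-map P f [] = refl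
length-filter-map P f (x ∷ xs) with P (f x)
... | true  = cong suc (length-filter-map P f xs)
... | false = length-filter-map P f xs

size≡count : ∀ n (𝓕 : Family n) → size 𝓕 ≡ count n 𝓕
size≡count zero 𝓕 with 𝓕 []
... | true  = refl
... | false = refl
size≡count (suc n) 𝓕 = begin
    length (filter P (mapᴸ (true ∷_) xs ++ᴸ mapᴸ (false ∷_) xs))
  ≡⟨ cong length (ListP.filter-++ P (mapᴸ (true ∷_) xs) (mapᴸ (false ∷_) xs)) ⟩
    length (filter P (mapᴸ (true ∷_) xs) ++ᴸ filter P (mapᴸ (false ∷_) xs))
  ≡⟨ ListP.length-++ (filter P (mapᴸ (true ∷_) xs)) ⟩
    length (filter P (mapᴸ (true ∷_) xs)) + length (filter P (mapᴸ (false ∷_) xs))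
  ≡⟨ cong₂ _+_ (trans (length-filter-map 𝓕 (true ∷_) xs) (size≡count n (𝓕 ∘ (true ∷_))))
               (trans (length-filter-map 𝓕 (false ∷_) xs) (size≡count n (𝓕 ∘ (false ∷_)))) ⟩
    count (suc n) 𝓕 ∎
  where
  open ≡-Reasoning
  xs = allSubsets n
  P = T? ∘ 𝓕

layer : ∀ {m} → ℕ → Family m
layer b A = ∣ A ∣ ≡ᵇ b

uniform⇒⊆layer : ∀ {m k} {𝓕 : Family m} → UniformFamily k 𝓕 → ∀ A → A ∈F 𝓕 → A ∈F layer k
uniform⇒⊆layer uni A A∈𝓕 = ≡⇒≡ᵇ _ _ (uni A A∈𝓕)

∣p∷ʳtrue∣≡1+∣p∣ : ∀ {m} (p : Subset m) → ∣ p ∷ʳ true ∣ ≡ suc ∣ p ∣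
∣p∷ʳtrue∣≡1+∣p∣ []          = refl
∣p∷ʳtrue∣≡1+∣p∣ (true ∷ p)  = cong suc (∣p∷ʳtrue∣≡1+∣p∣ p)
∣p∷ʳtrue∣≡1+∣p∣ (false ∷ p) = ∣p∷ʳtrue∣≡1+∣p∣ p

∣p∷ʳfalse∣≡∣p∣ : ∀ {m} (p : Subset m) → ∣ p ∷ʳ false ∣ ≡ ∣ p ∣
∣p∷ʳfalse∣≡∣p∣ []          = refl
∣p∷ʳfalse∣≡∣p∣ (true ∷ p)  = cong suc (∣p∷ʳfalse∣≡∣p∣ p)
∣p∷ʳfalse∣≡∣p∣ (false ∷ p) = ∣p∷ʳfalse∣≡∣p∣ p

∣p++q∣≡∣p∣+∣q∣ : ∀ {m n} (p : Subset m) (q : Subset n) → ∣ p ++ q ∣ ≡ ∣ p ∣ + ∣ q ∣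
∣p++q∣≡∣p∣+∣q∣ []          q = refl
∣p++q∣≡∣p∣+∣q∣ (true ∷ p)  q = cong suc (∣p++q∣≡∣p∣+∣q∣ p q)
∣p++q∣≡∣p∣+∣q∣ (false ∷ p) q = ∣p++q∣≡∣p∣+∣q∣ p q

∣∁p∣+∣p∣≡n : ∀ {n} (p : Subset n) → ∣ ∁ p ∣ + ∣ p ∣ ≡ n
∣∁p∣+∣p∣≡n p = trans (cong (_+ ∣ p ∣) (∣∁p∣≡n∸∣p∣ p)) (m∸n+n≡m (∣p∣≤n p))

layer-∷ʳ-true : ∀ {m} b (A : Subset m) → layer (suc b) (A ∷ʳ true) ≡ layer b A
layer-∷ʳ-true b A = cong (_≡ᵇ suc b) (∣p∷ʳtrue∣≡1+∣p∣ A)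

layer-∷ʳ-false : ∀ {m} b (A : Subset m) → layer b (A ∷ʳ false) ≡ layer b A
layer-∷ʳ-false b A = cong (_≡ᵇ b) (∣p∷ʳfalse∣≡∣p∣ A)

Intersects : ∀ {m} → Subset m → Subset m → Set
Intersects []      []      = ⊥
Intersects (a ∷ A) (b ∷ B) = T (a ∧ b) ⊎ Intersects A B

∈-both⇒Intersects : ∀ {m} {x : Fin m} {A B : Subset m} → x ∈ A → x ∈ B → Intersects A B
∈-both⇒Intersects here        here        = inj₁ tt
∈-both⇒Intersects (there x∈A) (there x∈B) = inj₂ (∈-both⇒Intersects x∈A x∈B)

Nonempty⇒Intersects : ∀ {m} (A B : Subset m) → Nonempty (A ∩ B) → Intersects A B
Nonempty⇒Intersects A B (_ , x∈A∩B) = uncurry ∈-both⇒Intersects (x∈p∩q⁻ A B x∈A∩B)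

Intersects⇒Nonempty : ∀ {m} (A B : Subset m) → Intersects A B → Nonempty (A ∩ B)
Intersects⇒Nonempty []          []          ()
Intersects⇒Nonempty (true ∷ A)  (true ∷ B)  (inj₁ _) = zero , here
Intersects⇒Nonempty (true ∷ A)  (false ∷ B) (inj₁ ())
Intersects⇒Nonempty (false ∷ A) (b ∷ B)     (inj₁ ())
Intersects⇒Nonempty (a ∷ A)     (b ∷ B)     (inj₂ A⋂B) with Intersects⇒Nonempty A B A⋂B
... | x , x∈A∩B = suc x , there x∈A∩B

Intersects-sym : ∀ {m} (A B : Subset m) → Intersects A B → Intersects B A
Intersects-sym []         []         ()
Intersects-sym (true ∷ A) (true ∷ B) (inj₁ _)   = inj₁ tt
Intersects-sym (a ∷ A)    (b ∷ B)    (inj₂ A⋂B) = inj₂ (Intersects-sym A B A⋂B)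

Intersects-++⁻ : ∀ {p m} (X Y : Subset p) (A B : Subset m) →
                 Intersects (X ++ A) (Y ++ B) → Intersects X Y ⊎ Intersects A B
Intersects-++⁻ []      []      A B A⋂B      = inj₂ A⋂B
Intersects-++⁻ (x ∷ X) (y ∷ Y) A B (inj₁ xy) = inj₁ (inj₁ xy)
Intersects-++⁻ (x ∷ X) (y ∷ Y) A B (inj₂ i)  = map₁ inj₂ (Intersects-++⁻ X Y A B i)

Intersects-∷ʳ-false⁻ : ∀ {m} (A B : Subset m) {x} → Intersects (A ∷ʳ x) (B ∷ʳ false) → Intersects A B
Intersects-∷ʳ-false⁻ []      []      {true}  (inj₁ ())
Intersects-∷ʳ-false⁻ []      []      {false} (inj₁ ())
Intersects-∷ʳ-false⁻ []      []              (inj₂ ())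
Intersects-∷ʳ-false⁻ (a ∷ A) (b ∷ B)         (inj₁ ab) = inj₁ ab
Intersects-∷ʳ-false⁻ (a ∷ A) (b ∷ B)         (inj₂ i)  = inj₂ (Intersects-∷ʳ-false⁻ A B i)

¬Intersects-∁ : ∀ {m} (A : Subset m) → ¬ Intersects A (∁ A)
¬Intersects-∁ (true ∷ A)  (inj₂ i) = ¬Intersects-∁ A i
¬Intersects-∁ (false ∷ A) (inj₂ i) = ¬Intersects-∁ A i

CrossIntersecting : ∀ {m} → Family m → Family m → Set
CrossIntersecting 𝓐 𝓑 = ∀ A B → A ∈F 𝓐 → B ∈F 𝓑 → Intersects A B

-- Shifts

data OneLess : ∀ {m} → Subset m → Subset m → Set where
  drop-head : ∀ {m} {U : Subset m} → OneLess (true ∷ U) (false ∷ U)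
  drop-tail : ∀ {m b} {U V : Subset m} → OneLess U V → OneLess (b ∷ U) (b ∷ V)

-- ShiftStep U V says V = S_{i,j}(U) ≠ U for some i < j; i is the first position where U and V differ.
data ShiftStep : ∀ {m} → Subset m → Subset m → Set where
  shift-head : ∀ {m} {U V : Subset m} → OneLess U V → ShiftStep (false ∷ U) (true ∷ V)
  shift-tail : ∀ {m b} {U V : Subset m} → ShiftStep U V → ShiftStep (b ∷ U) (b ∷ V)

ShiftClosed : ∀ {m} → Family m → Set
ShiftClosed 𝓕 = ∀ U V → U ∈F 𝓕 → ShiftStep U V → V ∈F 𝓕

OneLess⇒update : ∀ {m} {U V : Subset m} → OneLess U V → ∃ λ j → lookup U j ≡ true × U [ j ]≔ false ≡ V
OneLess⇒update drop-head = zero , refl , refl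
OneLess⇒update (drop-tail U⊐V) with OneLess⇒update U⊐V
... | j , Uj≡true , refl = suc j , Uj≡true , refl

shiftSet-∷ : ∀ {m} (i j : Fin m) b (A : Subset m) → shiftSet (suc i) (suc j) (b ∷ A) ≡ b ∷ shiftSet i j A
shiftSet-∷ i j b A with lookup A j ∧ not (lookup A i)
... | true  = refl
... | false = refl

ShiftStep⇒shiftSet : ∀ {m} {U V : Subset m} → ShiftStep U V →
                     ∃₂ λ i j → toℕ i < toℕ j × shiftSet i j U ≡ V
ShiftStep⇒shiftSet (shift-head {U = U} U⊐V) with OneLess⇒update U⊐V
... | j , Uj≡true , refl =
  zero , suc j , z<s , cong (λ b → if b ∧ true then true ∷ (U [ j ]≔ false) else false ∷ U) Uj≡true
ShiftStep⇒shiftSet (shift-tail {b = b} {U = U} U↝V) with ShiftStep⇒shiftSet U↝V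
... | i , j , i<j , refl = suc i , suc j , s≤s i<j , shiftSet-∷ i j b U

Shifted⇒ShiftClosed : ∀ {m} (𝓕 : Family m) → Shifted 𝓕 → ShiftClosed 𝓕
Shifted⇒ShiftClosed 𝓕 shifted U V U∈𝓕 U↝V with ShiftStep⇒shiftSet U↝V
... | i , j , i<j , SᵢⱼU≡V = proj₁ (shifted i j i<j V) (inj₁ (U , U∈𝓕 , SᵢⱼU≡V))

OneLess-last : ∀ {m} (U : Subset m) → OneLess (U ∷ʳ true) (U ∷ʳ false)
OneLess-last []      = drop-head
OneLess-last (_ ∷ U) = drop-tail (OneLess-last U)

OneLess-∷ʳ : ∀ {m} {U V : Subset m} x → OneLess U V → OneLess (U ∷ʳ x) (V ∷ʳ x)
OneLess-∷ʳ x drop-head       = drop-head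
OneLess-∷ʳ x (drop-tail U⊐V) = drop-tail (OneLess-∷ʳ x U⊐V)

ShiftStep-∷ʳ : ∀ {m} {U V : Subset m} x → ShiftStep U V → ShiftStep (U ∷ʳ x) (V ∷ʳ x)
ShiftStep-∷ʳ x (shift-head U⊐V) = shift-head (OneLess-∷ʳ x U⊐V)
ShiftStep-∷ʳ x (shift-tail U↝V) = shift-tail (ShiftStep-∷ʳ x U↝V)

ShiftStep-++ : ∀ {p m} (X : Subset p) {U V : Subset m} → ShiftStep U V → ShiftStep (X ++ U) (X ++ V)
ShiftStep-++ []      U↝V = U↝V
ShiftStep-++ (_ ∷ X) U↝V = shift-tail (ShiftStep-++ X U↝V)

ShiftClosed-∷ʳ : ∀ {m} {𝓕 : Family (suc m)} x → ShiftClosed 𝓕 → ShiftClosed (𝓕 ∘ (_∷ʳ x))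
ShiftClosed-∷ʳ x closed U V U∈ U↝V = closed _ _ U∈ (ShiftStep-∷ʳ x U↝V)

ShiftClosed-++ : ∀ {p m} {𝓕 : Family (p + m)} (X : Subset p) → ShiftClosed 𝓕 → ShiftClosed (𝓕 ∘ (X ++_))
ShiftClosed-++ X closed U V U∈ U↝V = closed _ _ U∈ (ShiftStep-++ X U↝V)

-- The last element of U moves to the first position outside S ∪ U, which exists by counting.
shift-last-into-gap : ∀ {m} (S U : Subset m) → ∣ S ∣ + ∣ U ∣ < m →
  ∃ λ V → ShiftStep (U ∷ʳ true) (V ∷ʳ false) × (Intersects S V → Intersects S U)
shift-last-into-gap (false ∷ S) (false ∷ U) _ =
  true ∷ U , shift-head (OneLess-last U) , λ { (inj₁ ()) ; (inj₂ S⋂U) → inj₂ S⋂U }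
shift-last-into-gap (true ∷ S) (false ∷ U) (s≤s gap) with shift-last-into-gap S U gap
... | V , U↝V , S⋂V⇒S⋂U = false ∷ V , shift-tail U↝V , map₂ S⋂V⇒S⋂U
shift-last-into-gap (true ∷ S) (true ∷ U) (s≤s gap)
  with shift-last-into-gap S U (≤-<-trans (+-monoʳ-≤ ∣ S ∣ (n≤1+n ∣ U ∣)) gap)
... | V , U↝V , S⋂V⇒S⋂U = true ∷ V , shift-tail U↝V , map₂ S⋂V⇒S⋂U
shift-last-into-gap (false ∷ S) (true ∷ U) (s≤s gap)
  with shift-last-into-gap S U (≤-trans (≤-reflexive (sym (+-suc ∣ S ∣ ∣ U ∣))) gap)
... | V , U↝V , S⋂V⇒S⋂U = true ∷ V , shift-tail U↝V , map₂ S⋂V⇒S⋂U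

-- Shifted cross-intersecting families

Uniform-∷ʳ-false : ∀ {m a} {𝓐 : Family (suc m)} → UniformFamily a 𝓐 → UniformFamily a (𝓐 ∘ (_∷ʳ false))
Uniform-∷ʳ-false uni A A∈ = trans (sym (∣p∷ʳfalse∣≡∣p∣ A)) (uni _ A∈)

Uniform-∷ʳ-true : ∀ {m a} {𝓐 : Family (suc m)} → UniformFamily (suc a) 𝓐 → UniformFamily a (𝓐 ∘ (_∷ʳ true))
Uniform-∷ʳ-true uni A A∈ = suc-injective (trans (sym (∣p∷ʳtrue∣≡1+∣p∣ A)) (uni _ A∈))

CrossIntersecting-∷ʳ-false : ∀ {m} {𝓐 𝓑 : Family (suc m)} x → CrossIntersecting 𝓐 𝓑 →
                             CrossIntersecting (𝓐 ∘ (_∷ʳ x)) (𝓑 ∘ (_∷ʳ false))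
CrossIntersecting-∷ʳ-false x cross A B A∈ B∈ = Intersects-∷ʳ-false⁻ A B (cross _ _ A∈ B∈)

CrossIntersecting-∷ʳ-true : ∀ {m a b} {𝓐 𝓑 : Family (suc m)} → a + b < m →
  UniformFamily (suc a) 𝓐 → UniformFamily (suc b) 𝓑 → ShiftClosed 𝓑 → CrossIntersecting 𝓐 𝓑 →
  CrossIntersecting (𝓐 ∘ (_∷ʳ true)) (𝓑 ∘ (_∷ʳ true))
CrossIntersecting-∷ʳ-true {m} {a} {b} a+b<m uniA uniB closedB cross A B A∈ B∈
  with shift-last-into-gap A B (subst (_< m) (sym (cong₂ _+_ ∣A∣≡a ∣B∣≡b)) a+b<m)
  where
  ∣A∣≡a = Uniform-∷ʳ-true uniA A A∈
  ∣B∣≡b = Uniform-∷ʳ-true uniB B B∈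
... | V , B↝V , A⋂V⇒A⋂B =
  A⋂V⇒A⋂B (Intersects-∷ʳ-false⁻ A V (cross _ _ A∈ (closedB _ _ B∈ B↝V)))

ShiftedCrossBound : ℕ → Set
ShiftedCrossBound m = ∀ a b → a ≤ b → a + b ≤ m → (𝓐 𝓑 : Family m) →
  UniformFamily a 𝓐 → UniformFamily b 𝓑 → CrossIntersecting 𝓐 𝓑 → ShiftClosed 𝓐 → ShiftClosed 𝓑 →
  count m 𝓐 + count m 𝓑 ≤ count m (layer b)

-- A ↦ ∁ A maps 𝓐 into the b-th layer, disjointly from 𝓑.
complementary-cross-bound : ∀ m a b → a + b ≡ m → (𝓐 𝓑 : Family m) →
  UniformFamily a 𝓐 → UniformFamily b 𝓑 → CrossIntersecting 𝓐 𝓑 →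
  count m 𝓐 + count m 𝓑 ≤ count m (layer b)
complementary-cross-bound m a b a+b≡m 𝓐 𝓑 uniA uniB cross = begin
    count m 𝓐 + count m 𝓑        ≡⟨ cong (_+ count m 𝓑) (count-∁ m 𝓐) ⟨
    count m (𝓐 ∘ ∁) + count m 𝓑  ≤⟨ count-disjoint m ∁𝓐⊆layer (uniform⇒⊆layer uniB) disjoint ⟩
    count m (layer b)             ∎
  where
  open ≤-Reasoning
  ∁𝓐⊆layer : ∀ A → ∁ A ∈F 𝓐 → A ∈F layer b
  ∁𝓐⊆layer A ∁A∈ = ≡⇒≡ᵇ _ _ (+-cancelˡ-≡ a _ _ (begin-equality
    a + ∣ A ∣      ≡⟨ cong (_+ ∣ A ∣) (uniA _ ∁A∈) ⟨
    ∣ ∁ A ∣ + ∣ A ∣ ≡⟨ ∣∁p∣+∣p∣≡n A ⟩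
    m             ≡⟨ a+b≡m ⟨
    a + b         ∎))
  disjoint : ∀ A → ∁ A ∈F 𝓐 → ¬ A ∈F 𝓑
  disjoint A ∁A∈ A∈ = ¬Intersects-∁ A (Intersects-sym (∁ A) A (cross _ _ ∁A∈ A∈))

with-last-bound : ∀ m → ShiftedCrossBound m → ∀ a b → a ≤ b → a + b < suc m → (𝓐 𝓑 : Family (suc m)) →
  UniformFamily a 𝓐 → UniformFamily b 𝓑 → CrossIntersecting 𝓐 𝓑 → ShiftClosed 𝓐 → ShiftClosed 𝓑 →
  count m (𝓐 ∘ (_∷ʳ true)) + count m (𝓑 ∘ (_∷ʳ true)) ≤ count m (layer b ∘ (_∷ʳ true))
with-last-bound m _ zero b _ _ 𝓐 𝓑 uniA uniB _ _ _ = begin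
    count m (𝓐 ∘ (_∷ʳ true)) + count m (𝓑 ∘ (_∷ʳ true))
  ≡⟨ cong (_+ count m (𝓑 ∘ (_∷ʳ true)))
          (count-empty m (λ A A∈ → 1+n≢0 (trans (sym (∣p∷ʳtrue∣≡1+∣p∣ A)) (uniA _ A∈)))) ⟩
    count m (𝓑 ∘ (_∷ʳ true))
  ≤⟨ count-mono m (λ A → uniform⇒⊆layer uniB (A ∷ʳ true)) ⟩
    count m (layer b ∘ (_∷ʳ true)) ∎
  where open ≤-Reasoning
with-last-bound m _ (suc a) zero () _ _ _ _ _ _ _ _
with-last-bound m bound (suc a) (suc b) (s≤s a≤b) (s≤s a+1+b<m) 𝓐 𝓑 uniA uniB cross closedA closedB = begin
    count m (𝓐 ∘ (_∷ʳ true)) + count m (𝓑 ∘ (_∷ʳ true))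
  ≤⟨ bound a b a≤b (<⇒≤ a+b<m) _ _ (Uniform-∷ʳ-true uniA) (Uniform-∷ʳ-true uniB)
       (CrossIntersecting-∷ʳ-true a+b<m uniA uniB closedB cross) (ShiftClosed-∷ʳ true closedA) (ShiftClosed-∷ʳ true closedB) ⟩
    count m (layer b)
  ≡⟨ count-cong m (layer-∷ʳ-true b) ⟨
    count m (layer (suc b) ∘ (_∷ʳ true)) ∎
  where
  open ≤-Reasoning
  a+b<m : a + b < m
  a+b<m = ≤-<-trans (+-monoʳ-≤ a (n≤1+n b)) a+1+b<m

without-last-bound : ∀ m → ShiftedCrossBound m → ∀ a b → a ≤ b → a + b < suc m → (𝓐 𝓑 : Family (suc m)) →
  UniformFamily a 𝓐 → UniformFamily b 𝓑 → CrossIntersecting 𝓐 𝓑 → ShiftClosed 𝓐 → ShiftClosed 𝓑 →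
  count m (𝓐 ∘ (_∷ʳ false)) + count m (𝓑 ∘ (_∷ʳ false)) ≤ count m (layer b ∘ (_∷ʳ false))
without-last-bound m bound a b a≤b a+b<1+m 𝓐 𝓑 uniA uniB cross closedA closedB = begin
    count m (𝓐 ∘ (_∷ʳ false)) + count m (𝓑 ∘ (_∷ʳ false))
  ≤⟨ bound a b a≤b (s≤s⁻¹ a+b<1+m) _ _ (Uniform-∷ʳ-false uniA) (Uniform-∷ʳ-false uniB)
       (CrossIntersecting-∷ʳ-false false cross) (ShiftClosed-∷ʳ false closedA) (ShiftClosed-∷ʳ false closedB) ⟩
    count m (layer b)
  ≡⟨ count-cong m (layer-∷ʳ-false b) ⟨
    count m (layer b ∘ (_∷ʳ false)) ∎
  where open ≤-Reasoning

shifted-cross-intersecting-bound : ∀ m → ShiftedCrossBound m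
shifted-cross-intersecting-bound m a b a≤b a+b≤m 𝓐 𝓑 uniA uniB cross closedA closedB with a + b ≟ m
... | yes a+b≡m = complementary-cross-bound m a b a+b≡m 𝓐 𝓑 uniA uniB cross
shifted-cross-intersecting-bound zero a b _ a+b≤0 _ _ _ _ _ _ _ | no a+b≢0 = ⊥-elim (a+b≢0 (n≤0⇒n≡0 a+b≤0))
shifted-cross-intersecting-bound (suc m) a b a≤b a+b≤1+m 𝓐 𝓑 uniA uniB cross closedA closedB | no a+b≢1+m = begin
    count (suc m) 𝓐 + count (suc m) 𝓑
  ≡⟨ cong₂ _+_ (count-∷ʳ m 𝓐) (count-∷ʳ m 𝓑) ⟩
    (count m 𝓐⁺ + count m 𝓐⁻) + (count m 𝓑⁺ + count m 𝓑⁻)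
  ≡⟨ +-interchange (count m 𝓐⁺) (count m 𝓐⁻) (count m 𝓑⁺) (count m 𝓑⁻) ⟩
    (count m 𝓐⁺ + count m 𝓑⁺) + (count m 𝓐⁻ + count m 𝓑⁻)
  ≤⟨ +-mono-≤ (with-last-bound m bound a b a≤b a+b<1+m 𝓐 𝓑 uniA uniB cross closedA closedB)
              (without-last-bound m bound a b a≤b a+b<1+m 𝓐 𝓑 uniA uniB cross closedA closedB) ⟩
    count m (layer b ∘ (_∷ʳ true)) + count m (layer b ∘ (_∷ʳ false))
  ≡⟨ count-∷ʳ m (layer b) ⟨
    count (suc m) (layer b) ∎
  where
  open ≤-Reasoning
  𝓐⁺ 𝓐⁻ 𝓑⁺ 𝓑⁻ : Family m
  𝓐⁺ = 𝓐 ∘ (_∷ʳ true)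
  𝓐⁻ = 𝓐 ∘ (_∷ʳ false)
  𝓑⁺ = 𝓑 ∘ (_∷ʳ true)
  𝓑⁻ = 𝓑 ∘ (_∷ʳ false)
  bound = shifted-cross-intersecting-bound m
  a+b<1+m = ≤∧≢⇒< a+b≤1+m a+b≢1+m

∩-seg-0 : ∀ {n} (A : Subset n) → A ∩ seg n 0 ≡ ∅
∩-seg-0 []      = refl
∩-seg-0 (a ∷ A) = cong₂ _∷_ (∧-zeroʳ a) (∩-seg-0 A)

∣∩seg∣-mono : ∀ {n c c′} → c ≤ c′ → (A : Subset n) → ∣ A ∩ seg n c ∣ ≤ ∣ A ∩ seg n c′ ∣
∣∩seg∣-mono {zero} _ [] = z≤n
∣∩seg∣-mono {n} {zero} {c′} _ A = subst (_≤ ∣ A ∩ seg n c′ ∣) (sym (trans (cong ∣_∣ (∩-seg-0 A)) (∣⊥∣≡0 n))) z≤n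
∣∩seg∣-mono {suc n} {suc c} {suc c′} (s≤s c≤c′) (true ∷ A)  = s≤s (∣∩seg∣-mono c≤c′ A)
∣∩seg∣-mono {suc n} {suc c} {suc c′} (s≤s c≤c′) (false ∷ A) = ∣∩seg∣-mono c≤c′ A

==ˢ⇒≡ : ∀ {n} {A B : Subset n} → T (A ==ˢ B) → A ≡ B
==ˢ⇒≡ {A = A} {B} A==B with ≡-dec BoolP._≟_ A B
... | yes A≡B = A≡B
... | no _    = ⊥-elim A==B

≡⇒==ˢ : ∀ {n} {A B : Subset n} → A ≡ B → T (A ==ˢ B)
≡⇒==ˢ {A = A} {B} A≡B with ≡-dec BoolP._≟_ A B
... | yes _   = tt
... | no A≢B = A≢B A≡B

famA-intro : ∀ {n} k l (F A : Subset n) → ∣ A ∣ ≡ k → A ∩ seg n (2 * l) ≡ F ∩ seg n (2 * l) → A ∈F famA k l F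
famA-intro k l F A ∣A∣≡k trace = from T-∧ (≡⇒≡ᵇ _ _ ∣A∣≡k , ≡⇒==ˢ trace)

famA-trace : ∀ {n} k l (F A : Subset n) → A ∈F famA k l F → A ∩ seg n (2 * l) ≡ F ∩ seg n (2 * l)
famA-trace k l F A A∈ = ==ˢ⇒≡ (proj₂ (to T-∧ A∈))

famB-intro : ∀ {n} k l (F B : Subset n) → ∣ B ∣ ≡ k → B ∩ seg n (2 * l) ≡ seg n (2 * l) ─ F → B ∈F famB k l F
famB-intro k l F B ∣B∣≡k trace = from T-∧ (≡⇒≡ᵇ _ _ ∣B∣≡k , ≡⇒==ˢ trace)

famB-trace : ∀ {n} k l (F B : Subset n) → B ∈F famB k l F → B ∩ seg n (2 * l) ≡ seg n (2 * l) ─ F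
famB-trace k l F B B∈ = ==ˢ⇒≡ (proj₂ (to T-∧ B∈))

newFamily-cases : ∀ {n} k l (F : Subset n) (𝓕 : Family n) A → A ∈F newFamily k l F 𝓕 →
                  A ∈F (𝓕 ∖ᶠ famA k l F) ⊎ A ∈F famB k l F
newFamily-cases k l F 𝓕 A = to (T-∨ {(𝓕 ∖ᶠ famA k l F) A} {famB k l F A})

-- Intersection and order of the new family

-- G and F first differ inside [c], at an element of G ∖ F, and H contains [c] ∖ F.
≺-meets-complement : ∀ n c (G F H : Subset n) → H ∩ seg n c ≡ seg n c ─ F →
                     G ∩ seg n c ≢ F ∩ seg n c → G ≺ F → Intersects G H
≺-meets-complement zero    c       []         []         []         _     G≢F _ = ⊥-elim (G≢F refl)
≺-meets-complement (suc n) zero    G          F          _          _     G≢F _ =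
  ⊥-elim (G≢F (trans (∩-seg-0 G) (sym (∩-seg-0 F))))
≺-meets-complement (suc n) (suc c) (true ∷ G)  (false ∷ F) (true ∷ H)  _     _   _ = inj₁ tt
≺-meets-complement (suc n) (suc c) (true ∷ G)  (false ∷ F) (false ∷ H) ()    _   _
≺-meets-complement (suc n) (suc c) (true ∷ G)  (true ∷ F)  (_ ∷ H)     trace G≢F G≺F =
  inj₂ (≺-meets-complement n c G F H (∷-injectiveʳ trace) (G≢F ∘ cong (true ∷_)) G≺F)
≺-meets-complement (suc n) (suc c) (false ∷ G) (false ∷ F) (_ ∷ H)     trace G≢F G≺F =
  inj₂ (≺-meets-complement n c G F H (∷-injectiveʳ trace) (G≢F ∘ cong (false ∷_)) G≺F)

IsLexLast : ∀ {n} → Family n → Subset n → Set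
IsLexLast 𝓕 F = ∀ G → G ∈F 𝓕 → G ≢ F → G ≺ F

lexLast-avoids-first : ∀ {n} (𝓕 : Family (suc n)) → ¬ TriviallyIntersecting 𝓕 →
                       ∀ f F → (f ∷ F) ∈F 𝓕 → IsLexLast 𝓕 (f ∷ F) → f ≡ false
lexLast-avoids-first 𝓕 nontrivial false F _   _    = refl
lexLast-avoids-first 𝓕 nontrivial true  F F∈𝓕 last = ⊥-elim (nontrivial (zero , all∋first))
  where
  all∋first : ∀ A → A ∈F 𝓕 → zero ∈ A
  all∋first (true ∷ A)  _  = here
  all∋first (false ∷ A) A∈ = ⊥-elim (last (false ∷ A) A∈ λ ())

famB∋first : ∀ {n} k l (F : Subset n) B → B ∈F famB k (suc l) (false ∷ F) → zero ∈ B
famB∋first k l F (b ∷ B) B∈ with trans (sym (∧-identityʳ b)) (cong head (famB-trace k (suc l) (false ∷ F) (b ∷ B) B∈))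
... | refl = here

newFamily-intersecting-and-precedes : ∀ {n} k l (𝓕 : Family n) → UniformFamily k 𝓕 → NontriviallyIntersecting 𝓕 →
  (F : Subset n) → F ∈F 𝓕 → IsLexLast 𝓕 F → l ≥ 1 →
  Intersecting (newFamily k l F 𝓕) × (∀ G → G ∈F newFamily k l F 𝓕 → G ≺ F)
newFamily-intersecting-and-precedes k l 𝓕 _ (intersecting , _) [] F∈𝓕 _ _
  with () ← proj₁ (intersecting [] [] F∈𝓕 F∈𝓕)
newFamily-intersecting-and-precedes k (suc l) 𝓕 uni (intersecting , nontrivial) (f ∷ F) F∈𝓕 last _
  with lexLast-avoids-first 𝓕 nontrivial f F F∈𝓕 last
... | refl = intersecting′ , precedes
  where
  𝓐 = famA k (suc l) (false ∷ F)
  𝓑 = famB k (suc l) (false ∷ F)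
  survivor-trace : ∀ G → G ∈F (𝓕 ∖ᶠ 𝓐) →
                   G ∩ seg _ (2 * suc l) ≢ (false ∷ F) ∩ seg _ (2 * suc l)
  survivor-trace G G∈ trace = ∖ᶠ⇒∉ 𝓕 𝓐 G G∈ (famA-intro k (suc l) (false ∷ F) G (uni G (∖ᶠ⇒∈ 𝓕 𝓐 G G∈)) trace)
  survivor≢F : ∀ G → G ∈F (𝓕 ∖ᶠ 𝓐) → G ≢ false ∷ F
  survivor≢F G G∈ refl = survivor-trace G G∈ refl
  survivor-meets-𝓑 : ∀ G H → G ∈F (𝓕 ∖ᶠ 𝓐) → H ∈F 𝓑 → Intersects G H
  survivor-meets-𝓑 G H G∈ H∈ =
    ≺-meets-complement _ (2 * suc l) G (false ∷ F) H (famB-trace k (suc l) (false ∷ F) H H∈)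
      (survivor-trace G G∈) (last G (∖ᶠ⇒∈ 𝓕 𝓐 G G∈) (survivor≢F G G∈))
  intersecting′ : Intersecting (newFamily k (suc l) (false ∷ F) 𝓕)
  intersecting′ G H G∈ H∈ with newFamily-cases k (suc l) (false ∷ F) 𝓕 G G∈ | newFamily-cases k (suc l) (false ∷ F) 𝓕 H H∈
  ... | inj₁ G∈′ | inj₁ H∈′ = intersecting G H (∖ᶠ⇒∈ 𝓕 𝓐 G G∈′) (∖ᶠ⇒∈ 𝓕 𝓐 H H∈′)
  ... | inj₁ G∈′ | inj₂ H∈𝓑 = Intersects⇒Nonempty G H (survivor-meets-𝓑 G H G∈′ H∈𝓑)
  ... | inj₂ G∈𝓑 | inj₁ H∈′ = Intersects⇒Nonempty G H (Intersects-sym H G (survivor-meets-𝓑 H G H∈′ G∈𝓑))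
  ... | inj₂ G∈𝓑 | inj₂ H∈𝓑 = zero , x∈p∩q⁺ (famB∋first k l F G G∈𝓑 , famB∋first k l F H H∈𝓑)
  precedes : ∀ G → G ∈F newFamily k (suc l) (false ∷ F) 𝓕 → G ≺ (false ∷ F)
  precedes G G∈ with newFamily-cases k (suc l) (false ∷ F) 𝓕 G G∈
  ... | inj₁ G∈′ = last G (∖ᶠ⇒∈ 𝓕 𝓐 G G∈′) (survivor≢F G G∈′)
  ... | inj₂ G∈𝓑 with famB∋first k l F G G∈𝓑
  ... | here = tt

-- Size of the new family

seg-0-─ : ∀ {m} (Y : Subset m) → seg m 0 ─ Y ≡ ∅
seg-0-─ []          = refl
seg-0-─ (true ∷ Y)  = cong (false ∷_) (seg-0-─ Y)
seg-0-─ (false ∷ Y) = cong (false ∷_) (seg-0-─ Y)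

∩-seg-++ : ∀ {p m} (X : Subset p) (Y : Subset m) → (X ++ Y) ∩ seg (p + m) p ≡ X ++ ∅
∩-seg-++ []      Y = ∩-seg-0 Y
∩-seg-++ (x ∷ X) Y = cong₂ _∷_ (∧-identityʳ x) (∩-seg-++ X Y)

seg-─-++ : ∀ {p m} (X : Subset p) (Y : Subset m) → seg (p + m) p ─ (X ++ Y) ≡ ∁ X ++ ∅
seg-─-++ []          Y = seg-0-─ Y
seg-─-++ (true ∷ X)  Y = cong (false ∷_) (seg-─-++ X Y)
seg-─-++ (false ∷ X) Y = cong (true ∷_) (seg-─-++ X Y)

∣∩seg-++∣ : ∀ {p m} (X : Subset p) (Y : Subset m) → ∣ (X ++ Y) ∩ seg (p + m) p ∣ ≡ ∣ X ∣
∣∩seg-++∣ {p} {m} X Y = begin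
  ∣ (X ++ Y) ∩ seg (p + m) p ∣ ≡⟨ cong ∣_∣ (∩-seg-++ X Y) ⟩
  ∣ X ++ ∅ ∣             ≡⟨ ∣p++q∣≡∣p∣+∣q∣ X ∅ ⟩
  ∣ X ∣ + ∣ ∅ {m} ∣       ≡⟨ cong (∣ X ∣ +_) (∣⊥∣≡0 m) ⟩
  ∣ X ∣ + 0              ≡⟨ +-identityʳ _ ⟩
  ∣ X ∣                  ∎
  where open ≡-Reasoning

famA-prefix : ∀ {l m} k (u : Subset (2 * l)) (w : Subset m) X Y →
              (X ++ Y) ∈F famA k l (u ++ w) → X ≡ u
famA-prefix {l} k u w X Y X++Y∈ = ++-injectiveˡ X u (begin
  X ++ ∅                        ≡⟨ ∩-seg-++ X Y ⟨
  (X ++ Y) ∩ seg _ (2 * l)      ≡⟨ famA-trace k l (u ++ w) (X ++ Y) X++Y∈ ⟩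
  (u ++ w) ∩ seg _ (2 * l)      ≡⟨ ∩-seg-++ u w ⟩
  u ++ ∅                        ∎)
  where open ≡-Reasoning

famB-prefix : ∀ {l m} k (u : Subset (2 * l)) (w : Subset m) X Y →
              (X ++ Y) ∈F famB k l (u ++ w) → X ≡ ∁ u
famB-prefix {l} k u w X Y X++Y∈ = ++-injectiveˡ X (∁ u) (begin
  X ++ ∅                        ≡⟨ ∩-seg-++ X Y ⟨
  (X ++ Y) ∩ seg _ (2 * l)      ≡⟨ famB-trace k l (u ++ w) (X ++ Y) X++Y∈ ⟩
  seg _ (2 * l) ─ (u ++ w)      ≡⟨ seg-─-++ u w ⟩
  ∁ u ++ ∅                      ∎)
  where open ≡-Reasoning

famB-∁-prefix : ∀ {l m} k (u : Subset (2 * l)) (w : Subset m) t →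
                ∣ ∁ u ∣ + ∣ t ∣ ≡ k → (∁ u ++ t) ∈F famB k l (u ++ w)
famB-∁-prefix {l} k u w t size≡k =
  famB-intro k l (u ++ w) (∁ u ++ t) (trans (∣p++q∣≡∣p∣+∣q∣ (∁ u) t) size≡k)
    (trans (∩-seg-++ (∁ u) t) (sym (seg-─-++ u w)))

Uniform-++ : ∀ {p m k} {𝓕 : Family (p + m)} → UniformFamily k 𝓕 → (u : Subset p) →
             UniformFamily (k ∸ ∣ u ∣) (𝓕 ∘ (u ++_))
Uniform-++ uni u A A∈ =
  trans (sym (m+n∸m≡n ∣ u ∣ ∣ A ∣)) (cong (_∸ ∣ u ∣) (trans (sym (∣p++q∣≡∣p∣+∣q∣ u A)) (uni _ A∈)))

Intersecting⇒∁-prefix-cross : ∀ {p m} (𝓕 : Family (p + m)) → Intersecting 𝓕 → (u : Subset p) →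
                               CrossIntersecting (𝓕 ∘ (u ++_)) (𝓕 ∘ (∁ u ++_))
Intersecting⇒∁-prefix-cross 𝓕 intersecting u A B A∈ B∈
  with Intersects-++⁻ u (∁ u) A B (Nonempty⇒Intersects _ _ (intersecting _ _ A∈ B∈))
... | inj₁ u⋂∁u = ⊥-elim (¬Intersects-∁ u u⋂∁u)
... | inj₂ A⋂B  = A⋂B

complement-smaller : ∀ {l x y} → l ≤ x → y + x ≡ 2 * l → y ≤ x
complement-smaller {l} {x} {y} l≤x y+x≡2l = +-cancelʳ-≤ x y x (begin
  y + x  ≡⟨ y+x≡2l ⟩
  2 * l  ≤⟨ *-monoʳ-≤ 2 l≤x ⟩
  2 * x  ≡⟨ cong (x +_) (+-identityʳ x) ⟩
  x + x  ∎)
  where open ≤-Reasoning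

tail-budget : ∀ {k x y p m} → x ≤ k → y ≤ k → y + x ≡ p → 2 * k < p + m → (k ∸ x) + (k ∸ y) < m
tail-budget {k} {x} {y} {p} {m} x≤k y≤k y+x≡p 2k<p+m = +-cancelʳ-< (x + y) _ _ (begin-strict
  (k ∸ x) + (k ∸ y) + (x + y)  ≡⟨ +-interchange (k ∸ x) (k ∸ y) x y ⟩
  (k ∸ x + x) + (k ∸ y + y)    ≡⟨ cong₂ _+_ (m∸n+n≡m x≤k) (m∸n+n≡m y≤k) ⟩
  k + k                        ≡⟨ cong (k +_) (+-identityʳ k) ⟨
  2 * k                        <⟨ 2k<p+m ⟩
  p + m                        ≡⟨ +-comm p m ⟩
  m + p                        ≡⟨ cong (m +_) (trans (sym y+x≡p) (+-comm y x)) ⟩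
  m + (x + y)                  ∎)
  where open ≤-Reasoning

count-≤-newFamily : ∀ l m k (𝓕 : Family (2 * l + m)) → UniformFamily k 𝓕 → Intersecting 𝓕 → Shifted 𝓕 →
  (u : Subset (2 * l)) (w : Subset m) → (u ++ w) ∈F 𝓕 → l ≤ ∣ u ∣ → 2 * k < 2 * l + m →
  count (2 * l + m) 𝓕 ≤ count (2 * l + m) (newFamily k l (u ++ w) 𝓕)
count-≤-newFamily l m k 𝓕 uni intersecting shifted u w F∈𝓕 l≤∣u∣ 2k<n =
  +-cancelʳ-≤ (count n 𝓑) (count n 𝓕) (count n 𝓕′) (begin
    count n 𝓕 + count n 𝓑
  ≡⟨ cong₂ _+_ (count-split n 𝓕 𝓐) (count-split n 𝓑 𝓕) ⟩
    (count n (𝓕 ∖ᶠ 𝓐) + count n (𝓕 ∩ᶠ 𝓐)) + (count n (𝓑 ∖ᶠ 𝓕) + count n (𝓑 ∩ᶠ 𝓕))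
  ≡⟨ +-interchange (count n (𝓕 ∖ᶠ 𝓐)) (count n (𝓕 ∩ᶠ 𝓐)) (count n (𝓑 ∖ᶠ 𝓕)) (count n (𝓑 ∩ᶠ 𝓕)) ⟩
    (count n (𝓕 ∖ᶠ 𝓐) + count n (𝓑 ∖ᶠ 𝓕)) + (count n (𝓕 ∩ᶠ 𝓐) + count n (𝓑 ∩ᶠ 𝓕))
  ≤⟨ +-mono-≤ survivors≤𝓕′ (+-mono-≤ 𝓕∩𝓐≤tails 𝓑∩𝓕≤tails) ⟩
    count n 𝓕′ + (count m (𝓕 ∘ (u ++_)) + count m (𝓕 ∘ (∁ u ++_)))
  ≤⟨ +-monoʳ-≤ (count n 𝓕′) tails≤layer ⟩
    count n 𝓕′ + count m (layer b)
  ≤⟨ +-monoʳ-≤ (count n 𝓕′) layer≤𝓑 ⟩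
    count n 𝓕′ + count n 𝓑 ∎)
  where
  open ≤-Reasoning
  n = 2 * l + m
  𝓐 = famA k l (u ++ w)
  𝓑 = famB k l (u ++ w)
  𝓕′ = newFamily k l (u ++ w) 𝓕
  b = k ∸ ∣ ∁ u ∣
  ∣u∣≤k : ∣ u ∣ ≤ k
  ∣u∣≤k = ≤-trans (m≤m+n ∣ u ∣ ∣ w ∣) (≤-reflexive (trans (sym (∣p++q∣≡∣p∣+∣q∣ u w)) (uni _ F∈𝓕)))
  ∣∁u∣≤∣u∣ : ∣ ∁ u ∣ ≤ ∣ u ∣
  ∣∁u∣≤∣u∣ = complement-smaller l≤∣u∣ (∣∁p∣+∣p∣≡n u)
  ∣∁u∣≤k = ≤-trans ∣∁u∣≤∣u∣ ∣u∣≤k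
  survivors≤𝓕′ : count n (𝓕 ∖ᶠ 𝓐) + count n (𝓑 ∖ᶠ 𝓕) ≤ count n 𝓕′
  survivors≤𝓕′ = count-disjoint n
    (λ A A∈ → from (T-∨ {(𝓕 ∖ᶠ 𝓐) A} {𝓑 A}) (inj₁ A∈))
    (λ A A∈ → from (T-∨ {(𝓕 ∖ᶠ 𝓐) A} {𝓑 A}) (inj₂ (∖ᶠ⇒∈ 𝓑 𝓕 A A∈)))
    (λ A A∈ A∈′ → ∖ᶠ⇒∉ 𝓑 𝓕 A A∈′ (∖ᶠ⇒∈ 𝓕 𝓐 A A∈))
  𝓕∩𝓐≤tails : count n (𝓕 ∩ᶠ 𝓐) ≤ count m (𝓕 ∘ (u ++_))
  𝓕∩𝓐≤tails = ≤-trans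
    (≤-reflexive (count-++ (2 * l) m (𝓕 ∩ᶠ 𝓐) u (λ X Y X++Y∈ → famA-prefix {l} k u w X Y (∩ᶠ⇒∈ʳ 𝓕 𝓐 _ X++Y∈))))
    (count-mono m (λ t → ∩ᶠ⇒∈ˡ 𝓕 𝓐 (u ++ t)))
  𝓑∩𝓕≤tails : count n (𝓑 ∩ᶠ 𝓕) ≤ count m (𝓕 ∘ (∁ u ++_))
  𝓑∩𝓕≤tails = ≤-trans
    (≤-reflexive (count-++ (2 * l) m (𝓑 ∩ᶠ 𝓕) (∁ u) (λ X Y X++Y∈ → famB-prefix {l} k u w X Y (∩ᶠ⇒∈ˡ 𝓑 𝓕 _ X++Y∈))))
    (count-mono m (λ t → ∩ᶠ⇒∈ʳ 𝓑 𝓕 (∁ u ++ t)))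
  tails≤layer : count m (𝓕 ∘ (u ++_)) + count m (𝓕 ∘ (∁ u ++_)) ≤ count m (layer b)
  tails≤layer = shifted-cross-intersecting-bound m (k ∸ ∣ u ∣) b (∸-monoʳ-≤ k ∣∁u∣≤∣u∣)
    (<⇒≤ (tail-budget ∣u∣≤k ∣∁u∣≤k (∣∁p∣+∣p∣≡n u) 2k<n)) _ _
    (Uniform-++ uni u) (Uniform-++ uni (∁ u)) (Intersecting⇒∁-prefix-cross 𝓕 intersecting u)
    (ShiftClosed-++ u (Shifted⇒ShiftClosed 𝓕 shifted)) (ShiftClosed-++ (∁ u) (Shifted⇒ShiftClosed 𝓕 shifted))
  layer≤𝓑 : count m (layer b) ≤ count n 𝓑
  layer≤𝓑 = ≤-trans
    (count-mono m (λ t t∈ → famB-∁-prefix {l} k u w t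
      (trans (cong (∣ ∁ u ∣ +_) (≡ᵇ⇒≡ _ _ t∈)) (m+[n∸m]≡n ∣∁u∣≤k))))
    (count-++-≥ (2 * l) m 𝓑 (∁ u))

trace-fits : ∀ {n k l} {𝓕 : Family n} → UniformFamily k 𝓕 → ∀ F → F ∈F 𝓕 →
             l ≤ ∣ F ∩ seg n (2 * l) ∣ → 2 * k < n → 2 * l ≤ n
trace-fits uni F F∈𝓕 l≤trace 2k<n =
  ≤-trans (*-monoʳ-≤ 2 (≤-trans l≤trace (≤-trans (∣p∩q∣≤∣p∣ F _) (≤-reflexive (uni F F∈𝓕))))) (<⇒≤ 2k<n)

size-≤-newFamily : ∀ n k l (𝓕 : Family n) → UniformFamily k 𝓕 → Intersecting 𝓕 → Shifted 𝓕 →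
  (F : Subset n) → F ∈F 𝓕 → l ≤ ∣ F ∩ seg n (2 * l) ∣ → 2 * k < n → size 𝓕 ≤ size (newFamily k l F 𝓕)
size-≤-newFamily n k l 𝓕 uni intersecting shifted F F∈𝓕 l≤trace 2k<n
  with m≤n⇒∃[o]m+o≡n (trace-fits uni F F∈𝓕 l≤trace 2k<n)
... | m , refl with splitAt (2 * l) F
... | u , w , refl = subst₂ _≤_ (sym (size≡count n 𝓕)) (sym (size≡count n (newFamily k l (u ++ w) 𝓕)))
  (count-≤-newFamily l m k 𝓕 uni intersecting shifted u w F∈𝓕
    (subst (l ≤_) (∣∩seg-++∣ u w) l≤trace) 2k<n)

lemma1 : (n k : ℕ) → 0 < 2 * k → 2 * k < n →
    (𝓕 : Family n) → UniformFamily k 𝓕 → NontriviallyIntersecting 𝓕 → Shifted 𝓕 →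
    (F : Subset n) → F ∈F 𝓕 → (∀ G → G ∈F 𝓕 → G ≢ F → G ≺ F) →
    (l : ℕ) → l ≥ 1 → ∣ F ∩ seg n (2 * l ∸ 1) ∣ ≡ l →
    (∀ l′ → l′ ≥ 1 → ∣ F ∩ seg n (2 * l′ ∸ 1) ∣ ≡ l′ → l′ ≤ l) →
    Intersecting (newFamily k l F 𝓕)
      × (∀ G → G ∈F newFamily k l F 𝓕 → G ≺ F)
      × size 𝓕 ≤ size (newFamily k l F 𝓕)
lemma1 n k _ 2k<n 𝓕 uni nontrivially-intersecting shifted F F∈𝓕 F-last l l≥1 trace≡l _ =
  proj₁ intersecting-and-precedes , proj₂ intersecting-and-precedes ,
  size-≤-newFamily n k l 𝓕 uni (proj₁ nontrivially-intersecting) shifted F F∈𝓕 l≤trace 2k<n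
  where
  intersecting-and-precedes = newFamily-intersecting-and-precedes k l 𝓕 uni nontrivially-intersecting F F∈𝓕 F-last l≥1
  l≤trace : l ≤ ∣ F ∩ seg n (2 * l) ∣
  l≤trace = subst (_≤ ∣ F ∩ seg n (2 * l) ∣) trace≡l (∣∩seg∣-mono (m∸n≤m (2 * l) 1) F)
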